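{- Let $G$ be a graph and $v\in V(G)$. Then $v$ is a shedding vertex of $G$ if and only if $\varepsilon_{G-v}(A)=\varepsilon_G(A)$ for every independent set $A$ of $G-v$.
   Context: Graphs are finite, simple, undirected. $\mathrm{Ind}(G)$ is the family of independent sets (sets of pairwise non-adjacent vertices) of $G$. For $A\in\mathrm{Ind}(G)$, $\varepsilon_G(A)=\max\{|S|: A\subseteq S,\ S\in\mathrm{Ind}(G)\}$. $N(v)$ is the neighborhood of $v$, $N[v]=N(v)\cup\{v\}$, and for $U\subseteq V(G)$, $G-U$ is the subgraph induced by $V(G)\setminus U$; $G-v=G-\{v\}$. A vertex $v$ is a shedding vertex of $G$ if for every independent set $S$ of $G-N[v]$ there exists $u\in N(v)$ such that $S\cup\{u\}$ is independent. -}

module Defs where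

open import Data.Nat using (ℕ; _≤_)
open import Data.Fin using (Fin)
open import Data.Fin.Subset using (Subset; _∈_; _⊆_; _∪_; ⁅_⁆; ∣_∣)
open import Data.Product using (Σ; _×_)
open import Data.Unit using (⊤)
open import Relation.Nullary using (¬_)
open import Relation.Binary using (Decidable)
open import Relation.Binary.PropositionalEquality using (_≡_; _≢_)

record Graph (n : ℕ) : Set₁ where
  field
    Adj   : Fin n → Fin n → Set
    sym   : ∀ {x y} → Adj x y → Adj y x
    irrefl : ∀ {x} → ¬ Adj x x
    adj?  : Decidable Adj
open Graph public

Independent : ∀ {n} → Graph n → Subset n → Set
Independent G S = ∀ {x y} → x ∈ S → y ∈ S → ¬ Adj G x y

-- Induced subgraphs are described by a predicate P on vertices (the vertex set kept).
-- IndIn G P S  :  S ∈ Ind(G[P])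
IndIn : ∀ {n} → Graph n → (Fin n → Set) → Subset n → Set
IndIn G P S = (∀ {x} → x ∈ S → P x) × Independent G S

AllV : ∀ {n} → Fin n → Set
AllV _ = ⊤

MinusV : ∀ {n} → Fin n → Fin n → Set
MinusV v x = x ≢ v

MinusClosedNbhd : ∀ {n} → Graph n → Fin n → Fin n → Set
MinusClosedNbhd G v x = x ≢ v × ¬ Adj G v x

-- EpsIs G P A k  :  ε_{G[P]}(A) = k, i.e. k is the maximum size of an
-- independent set of G[P] containing A.
EpsIs : ∀ {n} → Graph n → (Fin n → Set) → Subset n → ℕ → Set
EpsIs G P A k =
  Σ (Subset _) (λ S → A ⊆ S × IndIn G P S × ∣ S ∣ ≡ k)
  × (∀ S → A ⊆ S → IndIn G P S → ∣ S ∣ ≤ k)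

Shedding : ∀ {n} → Graph n → Fin n → Set
Shedding G v =
  ∀ S → IndIn G (MinusClosedNbhd G v) S →
  Σ (Fin _) (λ u → Adj G v u × Independent G (S ∪ ⁅ u ⁆))

-- Removing v can only shrink ε, so the two agree exactly when every independent set S ⊇ A of G
-- can be traded for an independent set of G - v containing A that is at least as large.
-- A shedding vertex provides the trade: if v ∈ S, then S - v is independent in G - N[v], so
-- some neighbour u of v extends it to (S - v) ∪ {u}. Conversely, if an independent set S of
-- G - N[v] had no such u, a largest independent set T ⊇ S of G - v would avoid N(v), and then
-- T ∪ {v} would exceed ε_{G-v}(S) in G.
module Submission where

open import Defs
open import Data.Nat using (ℕ; suc; s≤s; _≤_; _<_; _<?_; _∸_)
open import Data.Nat.Induction using (<-wellFounded)
open import Data.Nat.Properties using (≤-refl; ≤-trans; ≤-antisym; n≤1+n; ≮⇒≥; <-irrefl; <-≤-trans; ∸-monoʳ-<; module ≤-Reasoning)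
open import Data.Fin using (Fin; zero; suc; _≟_)
open import Data.Fin.Properties using (any?)
open import Data.Fin.Subset using (Subset; Lift; _∈_; _∉_; _⊆_; _∪_; _-_; ⁅_⁆; ∣_∣; inside; outside)
open import Data.Fin.Subset.Properties
  using (_∈?_; _⊆?_; Lift?; anySubset?; ∣p∣≤n; p⊂q⇒∣p∣<∣q∣; ∪-identityʳ; p⊆q⇒∣p∣≤∣q∣; p─q⊆p; x∈p∧x≢y⇒x∈p-y; x∈p∪q⁺; x∈p∪q⁻; x∈⁅x⁆; x∈⁅y⁆⇒x≡y)
open import Data.Vec using (_∷_; there)
open import Data.Product using (∃; _×_; _,_; proj₁; proj₂)
open import Data.Sum using (inj₁; inj₂)
open import Data.Unit using (tt)
open import Data.Empty using (⊥-elim)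
open import Function using (_∘_)
open import Function.Bundles using (_⇔_; mk⇔; Equivalence)
open import Induction.WellFounded using (Acc; acc)
open import Relation.Nullary using (¬_; yes; no)
open import Relation.Nullary.Decidable using (_×-dec_; ¬?; map′)
open import Relation.Unary using (Pred; Decidable)
open import Relation.Binary.PropositionalEquality using (_≢_; refl; subst)

private
  variable
    n : ℕ

∣p∪⁅x⁆∣≤1+∣p∣ : ∀ (p : Subset n) x → ∣ p ∪ ⁅ x ⁆ ∣ ≤ suc ∣ p ∣
∣p∪⁅x⁆∣≤1+∣p∣ (inside ∷ p) zero rewrite ∪-identityʳ p = n≤1+n (suc ∣ p ∣)
∣p∪⁅x⁆∣≤1+∣p∣ (outside ∷ p) zero rewrite ∪-identityʳ p = ≤-refl
∣p∪⁅x⁆∣≤1+∣p∣ (inside ∷ p) (suc x) = s≤s (∣p∪⁅x⁆∣≤1+∣p∣ p x)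
∣p∪⁅x⁆∣≤1+∣p∣ (outside ∷ p) (suc x) = ∣p∪⁅x⁆∣≤1+∣p∣ p x

p⊆p-x∪⁅x⁆ : ∀ {p : Subset n} x → p ⊆ (p - x) ∪ ⁅ x ⁆
p⊆p-x∪⁅x⁆ x {y} y∈p with y ≟ x
... | yes refl = x∈p∪q⁺ (inj₂ (x∈⁅x⁆ y))
... | no y≢x = x∈p∪q⁺ (inj₁ (x∈p∧x≢y⇒x∈p-y y∈p y≢x))

x∉p-x : ∀ (p : Subset n) x → x ∉ p - x
x∉p-x (_ ∷ p) zero ()
x∉p-x (_ ∷ p) (suc x) (there x∈p-x) = x∉p-x p x x∈p-x

x∈p-y⇒x≢y : ∀ {p : Subset n} {x y} → x ∈ p - y → x ≢ y
x∈p-y⇒x≢y {p = p} {x} x∈p-y refl = x∉p-x p x x∈p-y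

∣p∣<∣p∪⁅x⁆∣ : ∀ {p : Subset n} {x} → x ∉ p → ∣ p ∣ < ∣ p ∪ ⁅ x ⁆ ∣
∣p∣<∣p∪⁅x⁆∣ {x = x} x∉p = p⊂q⇒∣p∣<∣q∣ (x∈p∪q⁺ ∘ inj₁ , x , x∈p∪q⁺ (inj₂ (x∈⁅x⁆ x)) , x∉p)

∣p∣≤∣p-x∪⁅y⁆∣ : ∀ {p : Subset n} {x y} → y ∉ p - x → ∣ p ∣ ≤ ∣ (p - x) ∪ ⁅ y ⁆ ∣
∣p∣≤∣p-x∪⁅y⁆∣ {p = p} {x} {y} y∉p-x = begin
  ∣ p ∣                 ≤⟨ p⊆q⇒∣p∣≤∣q∣ (p⊆p-x∪⁅x⁆ {p = p} x) ⟩
  ∣ (p - x) ∪ ⁅ x ⁆ ∣   ≤⟨ ∣p∪⁅x⁆∣≤1+∣p∣ (p - x) x ⟩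
  suc ∣ p - x ∣         ≤⟨ ∣p∣<∣p∪⁅x⁆∣ y∉p-x ⟩
  ∣ (p - x) ∪ ⁅ y ⁆ ∣   ∎
  where open ≤-Reasoning

module _ {ℓ} {P : Pred (Subset n) ℓ} (P? : Decidable P) where

  private
    largestFrom : ∀ S → Acc _<_ (n ∸ ∣ S ∣) → P S → ∃ λ T → P T × (∀ T′ → P T′ → ∣ T′ ∣ ≤ ∣ T ∣)
    largestFrom S (acc rs) pS with anySubset? (λ T → P? T ×-dec (∣ S ∣ <? ∣ T ∣))
    ... | yes (T , pT , S<T) = largestFrom T (rs (∸-monoʳ-< S<T (∣p∣≤n T))) pT
    ... | no noLarger = S , pS , λ T pT → ≮⇒≥ (λ S<T → noLarger (T , pT , S<T))

  largest : ∀ {S} → P S → ∃ λ T → P T × (∀ T′ → P T′ → ∣ T′ ∣ ≤ ∣ T ∣)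
  largest {S} = largestFrom S (<-wellFounded _)

module _ {n} (G : Graph n) where

  Independent? : Decidable (Independent G)
  Independent? S = map′ (λ ind {x} {y} x∈S → ind {x} x∈S {y}) (λ ind {x} x∈S {y} → ind {x} {y} x∈S)
    (Lift? (λ x → Lift? (λ y → ¬? (adj? G x y)) S) S)

  IndIn? : ∀ {P} → Decidable P → Decidable (IndIn G P)
  IndIn? P? S = Lift? P? S ×-dec Independent? S

  Independent-⊆ : ∀ {S T} → S ⊆ T → Independent G T → Independent G S
  Independent-⊆ S⊆T indT x∈S y∈S = indT (S⊆T x∈S) (S⊆T y∈S)

  Independent-∪⁅⁆ : ∀ {S x} → Independent G S → (∀ {y} → y ∈ S → ¬ Adj G x y) →
                    Independent G (S ∪ ⁅ x ⁆)
  Independent-∪⁅⁆ {S} {x} indS x≁S y∈ z∈ with x∈p∪q⁻ S ⁅ x ⁆ y∈ | x∈p∪q⁻ S ⁅ x ⁆ z∈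
  ... | inj₁ y∈S | inj₁ z∈S = indS y∈S z∈S
  ... | inj₁ y∈S | inj₂ z∈⁅x⁆ rewrite x∈⁅y⁆⇒x≡y x z∈⁅x⁆ = x≁S y∈S ∘ Graph.sym G
  ... | inj₂ y∈⁅x⁆ | inj₁ z∈S rewrite x∈⁅y⁆⇒x≡y x y∈⁅x⁆ = x≁S z∈S
  ... | inj₂ y∈⁅x⁆ | inj₂ z∈⁅x⁆ rewrite x∈⁅y⁆⇒x≡y x y∈⁅x⁆ | x∈⁅y⁆⇒x≡y x z∈⁅x⁆ = irrefl G

  ∃-EpsIs : ∀ {P A} → Decidable P → IndIn G P A → ∃ λ k → EpsIs G P A k
  ∃-EpsIs {P} {A} P? indA with largest (λ S → A ⊆? S ×-dec IndIn? P? S) ((λ x∈A → x∈A) , indA)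
  ... | T , (A⊆T , indT) , T-largest = ∣ T ∣ , (T , A⊆T , indT , refl) , λ S A⊆S indS → T-largest S (A⊆S , indS)

  EpsIs-restrict-⇔ : ∀ {P Q : Fin n → Set} {A k} → (∀ {x} → P x → Q x) →
                     (∀ S → A ⊆ S → IndIn G Q S → ∃ λ S* → A ⊆ S* × IndIn G P S* × ∣ S ∣ ≤ ∣ S* ∣) →
                     EpsIs G P A k ⇔ EpsIs G Q A k
  EpsIs-restrict-⇔ {P} {Q} {A} {k} P⊆Q dominate = mk⇔ to from
    where
    weaken : ∀ {S} → IndIn G P S → IndIn G Q S
    weaken (S⊆P , indS) = P⊆Q ∘ S⊆P , indS

    to : EpsIs G P A k → EpsIs G Q A k
    to ((T , A⊆T , indT , ∣T∣≡k) , bound) =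
      (T , A⊆T , weaken indT , ∣T∣≡k) , λ S A⊆S indS →
        let S* , A⊆S* , indS* , ∣S∣≤∣S*∣ = dominate S A⊆S indS in ≤-trans ∣S∣≤∣S*∣ (bound S* A⊆S* indS*)

    from : EpsIs G Q A k → EpsIs G P A k
    from ((T , A⊆T , indT , ∣T∣≡k) , bound) =
      let T* , A⊆T* , indT* , ∣T∣≤∣T*∣ = dominate T A⊆T indT in
      (T* , A⊆T* , indT* , ≤-antisym (bound T* A⊆T* (weaken indT*)) (subst (_≤ ∣ T* ∣) ∣T∣≡k ∣T∣≤∣T*∣)) ,
      λ S A⊆S indS → bound S A⊆S (weaken indS)

module _ {n} (G : Graph n) (v : Fin n) where

  S-v∈Ind[G-N[v]] : ∀ {S} → Independent G S → v ∈ S → IndIn G (MinusClosedNbhd G v) (S - v)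
  S-v∈Ind[G-N[v]] {S} indS v∈S = (λ x∈S-v → x∈p-y⇒x≢y x∈S-v , indS v∈S (S-v⊆S x∈S-v)) , Independent-⊆ G S-v⊆S indS
    where
    S-v⊆S : S - v ⊆ S
    S-v⊆S = p─q⊆p S ⁅ v ⁆

  shedding-exchange : Shedding G v → ∀ {A S} → v ∉ A → A ⊆ S → Independent G S →
                      ∃ λ S* → A ⊆ S* × IndIn G (MinusV v) S* × ∣ S ∣ ≤ ∣ S* ∣
  shedding-exchange shed {A} {S} v∉A A⊆S indS with v ∈? S
  ... | no v∉S = S , A⊆S , ((λ x∈S x≡v → v∉S (subst (_∈ S) x≡v x∈S)) , indS) , ≤-refl
  ... | yes v∈S with shed (S - v) (S-v∈Ind[G-N[v]] indS v∈S)
  ... | u , v~u , indS* = (S - v) ∪ ⁅ u ⁆ , A⊆S* , (S*-avoids-v , indS*) , ∣p∣≤∣p-x∪⁅y⁆∣ u∉S-v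
    where
    A⊆S* : A ⊆ (S - v) ∪ ⁅ u ⁆
    A⊆S* {x} x∈A = x∈p∪q⁺ (inj₁ (x∈p∧x≢y⇒x∈p-y (A⊆S x∈A) (λ x≡v → v∉A (subst (_∈ A) x≡v x∈A))))

    S*-avoids-v : Lift (MinusV v) ((S - v) ∪ ⁅ u ⁆)
    S*-avoids-v x∈S* with x∈p∪q⁻ (S - v) ⁅ u ⁆ x∈S*
    ... | inj₁ x∈S-v = x∈p-y⇒x≢y x∈S-v
    ... | inj₂ x∈⁅u⁆ rewrite x∈⁅y⁆⇒x≡y u x∈⁅u⁆ = λ { refl → irrefl G v~u }

    u∉S-v : u ∉ S - v
    u∉S-v u∈S-v = indS v∈S (p─q⊆p S ⁅ v ⁆ u∈S-v) v~u

  ε-preserved⇒shedding : (∀ A → IndIn G (MinusV v) A → ∀ k → EpsIs G (MinusV v) A k → EpsIs G AllV A k) →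
                         Shedding G v
  ε-preserved⇒shedding ε-preserved S (S⊆G-N[v] , indS)
    with any? (λ u → adj? G v u ×-dec Independent? G (S ∪ ⁅ u ⁆))
  ... | yes extension = extension
  ... | no noExtension with ∃-EpsIs G (λ x → ¬? (x ≟ v)) (proj₁ ∘ S⊆G-N[v] , indS)
  ... | k , ε@((T , S⊆T , (T⊆G-v , indT) , ∣T∣≡k) , _) =
    ⊥-elim (<-irrefl refl (<-≤-trans (subst (_< ∣ T ∪ ⁅ v ⁆ ∣) ∣T∣≡k (∣p∣<∣p∪⁅x⁆∣ v∉T)) T∪⁅v⁆-bounded))
    where
    v∉T : v ∉ T
    v∉T v∈T = T⊆G-v v∈T refl

    v≁T : ∀ {y} → y ∈ T → ¬ Adj G v y
    v≁T {y} y∈T v~y = noExtension (y , v~y , Independent-⊆ G S∪⁅y⁆⊆T indT)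
      where
      S∪⁅y⁆⊆T : S ∪ ⁅ y ⁆ ⊆ T
      S∪⁅y⁆⊆T z∈ with x∈p∪q⁻ S ⁅ y ⁆ z∈
      ... | inj₁ z∈S = S⊆T z∈S
      ... | inj₂ z∈⁅y⁆ rewrite x∈⁅y⁆⇒x≡y y z∈⁅y⁆ = y∈T

    T∪⁅v⁆-bounded : ∣ T ∪ ⁅ v ⁆ ∣ ≤ k
    T∪⁅v⁆-bounded = proj₂ (ε-preserved S (proj₁ ∘ S⊆G-N[v] , indS) k ε) (T ∪ ⁅ v ⁆)
      (x∈p∪q⁺ ∘ inj₁ ∘ S⊆T) ((λ _ → tt) , Independent-∪⁅⁆ G indT v≁T)

theorem3p2 : ∀ {n} (G : Graph n) (v : Fin n) →
    Shedding G v ⇔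
      (∀ (A : Subset n) → IndIn G (MinusV v) A →
        ∀ (k : ℕ) → EpsIs G (MinusV v) A k ⇔ EpsIs G AllV A k)
theorem3p2 G v = mk⇔
  (λ shed A (A⊆G-v , _) k → EpsIs-restrict-⇔ G (λ _ → tt)
    (λ S A⊆S → shedding-exchange G v shed (λ v∈A → A⊆G-v v∈A refl) A⊆S ∘ proj₂))
  (λ ε-equal → ε-preserved⇒shedding G v (λ A indA k → Equivalence.to (ε-equal A indA k)))
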